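{- $\mathrm{PEL} \ne \mathrm{ML}$; that is, the logics $\mathrm{PEL}$ and $\mathrm{ML}$ are not equivalent.
   Context: Formulas are built from propositional variables and constants $\top,\bot$ using $\land$ and $\to$; a sequent is $\Gamma\vdash\phi$ with $\Gamma$ a finite list of formulas. A rule is a derived rule of a logic if it can be obtained as a combination of its inference rules; $A\le B$ means every inference rule of $A$ is a derived rule of $B$; $A$ and $B$ are equivalent if $A\le B$ and $B\le A$. $\mathrm{PL}$ has the rules: $\vdash\top$; $\phi\vdash\phi$; from $\Gamma\vdash\psi$ infer $\Gamma,\phi\vdash\psi$; from $\Gamma\vdash\phi$ and $\Gamma,\phi\vdash\psi$ infer $\Gamma\vdash\psi$; from $\Gamma\vdash\phi\land\psi$ infer $\Gamma\vdash\phi$ and $\Gamma\vdash\psi$; from $\Gamma\vdash\phi$ and $\Gamma\vdash\psi$ infer $\Gamma\vdash\phi\land\psi$; from $\Gamma\vdash\phi$ and $\Gamma\vdash\phi\to\psi$ infer $\Gamma\vdash\psi$; from $\Gamma\vdash\psi$ infer $\Gamma\vdash\phi\to\psi$. $\mathrm{ML}$ is $\mathrm{PL}$ plus: from $\Gamma,\phi\vdash\psi$ infer $\Gamma\vdash\phi\to\psi$. $\mathrm{PEL}$ is $\mathrm{PL}$ plus (E1) from $\Gamma,\phi\vdash\psi$ and $\Gamma,\psi\vdash\phi$ infer $\Gamma,(\phi\to\chi)\vdash(\psi\to\chi)$ and (E2) from the same premises infer $\Gamma,(\chi\to\phi)\vdash(\chi\to\psi)$. -}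

module Defs where

open import Data.Nat using (ℕ)
open import Data.List using (List; []; _∷_; [_]; _++_)
open import Data.List.Membership.Propositional using (_∈_)
open import Data.List.Relation.Unary.All using (All)
open import Data.Product using (_×_)

data Formula : Set where
  var  : ℕ → Formula
  `⊤   : Formula
  `⊥   : Formula
  _∧_  : Formula → Formula → Formula
  _⇒_  : Formula → Formula → Formula

infixr 6 _∧_
infixr 5 _⇒_

infix 4 _⊢_
record Sequent : Set where
  constructor _⊢_
  field
    ctx   : List Formula
    concl : Formula

infixl 5 _,,_
_,,_ : List Formula → Formula → List Formula
Γ ,, φ = Γ ++ [ φ ]

Rule : Set₁
Rule = List Sequent → Sequent → Set

record Logic : Set₁ where
  field
    Idx  : Set
    rule : Idx → Rule
open Logic public

data Derivable (L : Logic) (hyps : List Sequent) : Sequent → Set where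
  hyp : ∀ {s} → s ∈ hyps → Derivable L hyps s
  app : ∀ (i : Idx L) {ps s} → rule L i ps s → All (Derivable L hyps) ps →
        Derivable L hyps s

DerivedRule : Logic → Rule → Set
DerivedRule L r = ∀ ps s → r ps s → Derivable L ps s

_≤L_ : Logic → Logic → Set
A ≤L B = ∀ (i : Idx A) → DerivedRule B (rule A i)

Equivalent : Logic → Logic → Set
Equivalent A B = (A ≤L B) × (B ≤L A)

data TopI : Rule where
  inst : TopI [] ([] ⊢ `⊤)

data Ax : Rule where
  inst : ∀ φ → Ax [] ([ φ ] ⊢ φ)

data Weak : Rule where
  inst : ∀ Γ φ ψ → Weak ((Γ ⊢ ψ) ∷ []) (Γ ,, φ ⊢ ψ)

data Cut : Rule where
  inst : ∀ Γ φ ψ → Cut ((Γ ⊢ φ) ∷ (Γ ,, φ ⊢ ψ) ∷ []) (Γ ⊢ ψ)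

data AndE₁ : Rule where
  inst : ∀ Γ φ ψ → AndE₁ ((Γ ⊢ φ ∧ ψ) ∷ []) (Γ ⊢ φ)

data AndE₂ : Rule where
  inst : ∀ Γ φ ψ → AndE₂ ((Γ ⊢ φ ∧ ψ) ∷ []) (Γ ⊢ ψ)

data AndI : Rule where
  inst : ∀ Γ φ ψ → AndI ((Γ ⊢ φ) ∷ (Γ ⊢ ψ) ∷ []) (Γ ⊢ φ ∧ ψ)

data ImpE : Rule where
  inst : ∀ Γ φ ψ → ImpE ((Γ ⊢ φ) ∷ (Γ ⊢ φ ⇒ ψ) ∷ []) (Γ ⊢ ψ)

data ImpK : Rule where
  inst : ∀ Γ φ ψ → ImpK ((Γ ⊢ ψ) ∷ []) (Γ ⊢ φ ⇒ ψ)

data Ded : Rule where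
  inst : ∀ Γ φ ψ → Ded ((Γ ,, φ ⊢ ψ) ∷ []) (Γ ⊢ φ ⇒ ψ)

data E1 : Rule where
  inst : ∀ Γ φ ψ χ → E1 ((Γ ,, φ ⊢ ψ) ∷ (Γ ,, ψ ⊢ φ) ∷ []) (Γ ,, (φ ⇒ χ) ⊢ (ψ ⇒ χ))

data E2 : Rule where
  inst : ∀ Γ φ ψ χ → E2 ((Γ ,, φ ⊢ ψ) ∷ (Γ ,, ψ ⊢ φ) ∷ []) (Γ ,, (χ ⇒ φ) ⊢ (χ ⇒ ψ))

data PLIdx : Set where
  top ax weak cut andE₁ andE₂ andI impE impK : PLIdx

plRule : PLIdx → Rule
plRule top   = TopI
plRule ax    = Ax
plRule weak  = Weak
plRule cut   = Cut
plRule andE₁ = AndE₁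
plRule andE₂ = AndE₂
plRule andI  = AndI
plRule impE  = ImpE
plRule impK  = ImpK

PL : Logic
PL = record { Idx = PLIdx ; rule = plRule }

data MLIdx : Set where
  pl  : PLIdx → MLIdx
  ded : MLIdx

mlRule : MLIdx → Rule
mlRule (pl i) = plRule i
mlRule ded    = Ded

ML : Logic
ML = record { Idx = MLIdx ; rule = mlRule }

data PELIdx : Set where
  pl : PLIdx → PELIdx
  e1 e2 : PELIdx

pelRule : PELIdx → Rule
pelRule (pl i) = plRule i
pelRule e1     = E1
pelRule e2     = E2

PEL : Logic
PEL = record { Idx = PELIdx ; rule = pelRule }

{-# OPTIONS --safe #-}
-- Read every implication φ → ψ as its consequent ψ, and every variable as
-- false. All rules of PEL preserve validity under this reading (the
-- conclusion of E1 is then an axiom, that of E2 the first premise), hence so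
-- does every derived rule of PEL. The deduction rule does not: p ⊢ p is
-- valid but ⊢ p → p reads as ⊢ p. So ML ≤ PEL fails.
module Submission where

open import Data.Empty using (⊥)
open import Data.List using (List; [])
open import Data.List.Relation.Unary.All as All using (All; []; _∷_)
open import Data.List.Relation.Unary.All.Properties using (∷ʳ⁺; ∷ʳ⁻)
open import Data.Product using (_×_; _,_; proj₁; proj₂)
open import Data.Unit using (⊤; tt)
open import Relation.Nullary using (¬_)

open import Defs

module Semantics (⟦_⟧ : Formula → Set) where

  Valid : Sequent → Set
  Valid (Γ ⊢ φ) = All ⟦_⟧ Γ → ⟦ φ ⟧

  SoundRule : Rule → Set
  SoundRule r = ∀ {ps s} → r ps s → All Valid ps → Valid s

  SoundLogic : Logic → Set
  SoundLogic L = ∀ i → SoundRule (rule L i)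

  module _ {L : Logic} (sound-L : SoundLogic L)
           {hs : List Sequent} (valid-hs : All Valid hs) where

    derivable-valid : ∀ {s} → Derivable L hs s → Valid s
    all-derivable-valid : ∀ {ps} → All (Derivable L hs) ps → All Valid ps

    derivable-valid (hyp s∈hs) = All.lookup valid-hs s∈hs
    derivable-valid (app i r ds) = sound-L i r (all-derivable-valid ds)

    all-derivable-valid [] = []
    all-derivable-valid (d ∷ ds) = derivable-valid d ∷ all-derivable-valid ds

  derivedRule-sound : ∀ {L r} → SoundLogic L → DerivedRule L r → SoundRule r
  derivedRule-sound sound-L derived r-inst valid-ps =
    derivable-valid sound-L valid-ps (derived _ _ r-inst)

  ≤L-soundLogic : ∀ {A B} → A ≤L B → SoundLogic B → SoundLogic A
  ≤L-soundLogic A≤B sound-B i = derivedRule-sound sound-B (A≤B i)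

⟦_⟧ᶜ : Formula → Set
⟦ var _ ⟧ᶜ = ⊥
⟦ `⊤ ⟧ᶜ    = ⊤
⟦ `⊥ ⟧ᶜ    = ⊥
⟦ φ ∧ ψ ⟧ᶜ = ⟦ φ ⟧ᶜ × ⟦ ψ ⟧ᶜ
⟦ φ ⇒ ψ ⟧ᶜ = ⟦ ψ ⟧ᶜ

open Semantics ⟦_⟧ᶜ

PEL-sound : SoundLogic PEL
PEL-sound (pl top)   inst           []                 _ = tt
PEL-sound (pl ax)    (inst φ)       []                 (x ∷ []) = x
PEL-sound (pl weak)  (inst Γ φ ψ)   (⊢ψ ∷ [])          γ = ⊢ψ (proj₁ (∷ʳ⁻ {xs = Γ} γ))
PEL-sound (pl cut)   (inst Γ φ ψ)   (⊢φ ∷ φ⊢ψ ∷ [])    γ = φ⊢ψ (∷ʳ⁺ γ (⊢φ γ))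
PEL-sound (pl andE₁) (inst Γ φ ψ)   (⊢φ∧ψ ∷ [])        γ = proj₁ (⊢φ∧ψ γ)
PEL-sound (pl andE₂) (inst Γ φ ψ)   (⊢φ∧ψ ∷ [])        γ = proj₂ (⊢φ∧ψ γ)
PEL-sound (pl andI)  (inst Γ φ ψ)   (⊢φ ∷ ⊢ψ ∷ [])     γ = ⊢φ γ , ⊢ψ γ
PEL-sound (pl impE)  (inst Γ φ ψ)   (_ ∷ ⊢φ⇒ψ ∷ [])    γ = ⊢φ⇒ψ γ
PEL-sound (pl impK)  (inst Γ φ ψ)   (⊢ψ ∷ [])          γ = ⊢ψ γ
PEL-sound e1         (inst Γ φ ψ χ) _                  γ = proj₂ (∷ʳ⁻ {xs = Γ} γ)
PEL-sound e2         (inst Γ φ ψ χ) (φ⊢ψ ∷ _)          γ =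
  let (γ′ , φ′) = ∷ʳ⁻ {xs = Γ} γ in φ⊢ψ (∷ʳ⁺ γ′ φ′)

Ded-unsound : ¬ SoundRule Ded
Ded-unsound sound = sound (inst [] p p) ((λ { (x ∷ []) → x }) ∷ []) []
  where p = var 0

lemma5p2 : ¬ Equivalent PEL ML
lemma5p2 (_ , ML≤PEL) = Ded-unsound (≤L-soundLogic ML≤PEL PEL-sound ded)
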